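{- Every $n\times m$ binary matrix $A$ has at most one base (with respect to the binary rank) that is disjoint in rows.
   Context: A binary matrix has entries in $\{0,1\}$. A set $X$ of binary vectors spans a vector $y$ if $y$ is the ordinary sum of a subset of $X$. A base of $A$ is a set of vectors in $\{0,1\}^n$ spanning all columns of $A$ of minimum cardinality among such spanning sets (its size equals the binary rank of $A$, the minimal $k$ with $A=UV$, $U,V$ binary $n\times k$ and $k\times m$). A base is disjoint in rows if no two of its vectors have a $1$ in the same coordinate. -}

module Defs where

open import Data.Nat using (ℕ; zero; suc; _+_; _≤_)
open import Data.Bool using (Bool; true; false; if_then_else_)
open import Data.Fin using (Fin)
open import Data.Vec using (Vec; lookup; tabulate)
open import Data.Product using (Σ; ∃; _×_)
open import Relation.Binary.PropositionalEquality using (_≡_; _≢_)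
open import Relation.Nullary using (¬_)
open import Function.Definitions using (Injective)

BinVec : ℕ → Set
BinVec n = Vec Bool n

BinMatrix : ℕ → ℕ → Set
BinMatrix n m = Fin n → Fin m → Bool

column : ∀ {n m} → BinMatrix n m → Fin m → BinVec n
column A j = tabulate (λ i → A i j)

val : Bool → ℕ
val true  = 1
val false = 0

Σ< : ∀ k → (Fin k → ℕ) → ℕ
Σ< zero    f = 0
Σ< (suc k) f = f Fin.zero + Σ< k (λ i → f (Fin.suc i))

record VecSet (n : ℕ) : Set where
  field
    size  : ℕ
    elem  : Fin size → BinVec n
    distinct : Injective _≡_ _≡_ elem
open VecSet public

-- X spans y: y is the ordinary (integer, coordinatewise) sum of a subset S of X
Spans : ∀ {n} → VecSet n → BinVec n → Set
Spans X y = Σ (Fin (size X) → Bool) λ S →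
  ∀ i → Σ< (size X) (λ a → if S a then val (lookup (elem X a) i) else 0)
        ≡ val (lookup y i)

SpansAllColumns : ∀ {n m} → BinMatrix n m → VecSet n → Set
SpansAllColumns A X = ∀ j → Spans X (column A j)

IsBase : ∀ {n m} → BinMatrix n m → VecSet n → Set
IsBase {n} A X = SpansAllColumns A X × (∀ (Y : VecSet n) → SpansAllColumns A Y → size X ≤ size Y)

DisjointInRows : ∀ {n} → VecSet n → Set
DisjointInRows X = ∀ a b → a ≢ b → ∀ i →
  ¬ (lookup (elem X a) i ≡ true × lookup (elem X b) i ≡ true)

SameSet : ∀ {n} → VecSet n → VecSet n → Set
SameSet X Y = (∀ a → ∃ λ b → elem Y b ≡ elem X a) × (∀ b → ∃ λ a → elem X a ≡ elem Y b)

-- Let X be a base of A that is disjoint in rows. Row i of A is produced by the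
-- unique vector of X with a 1 in row i (or is zero if there is none), so it equals
-- the pattern of coefficients with which that vector enters the columns.
-- Minimality forbids a vector that is zero or never used (drop it) and two vectors
-- with the same pattern (replace them by their union). Hence the support of each
-- vector of X is exactly one class of equal nonzero rows of A, and X is
-- determined by A alone.
module Submission where

open import Defs
open import Data.Nat.Properties
  using (+-comm; +-identityʳ; n≮n; +-0-commutativeMonoid; +-commutativeSemigroup)
open import Algebra.Properties.CommutativeMonoid.Sum +-0-commutativeMonoid using (sum; sum-remove)
open import Algebra.Properties.CommutativeSemigroup +-commutativeSemigroup using (xy∙z≈xz∙y)
open import Data.Bool using (Bool; true; false; _∨_; if_then_else_)
open import Data.Bool.Properties using (¬-not; ⇔→≡) renaming (_≟_ to _≟ᴮ_)
open import Data.Empty using (⊥-elim)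
open import Data.Fin using (Fin; zero; suc; punchIn; punchOut)
open import Data.Fin.Properties
  using (punchIn-injective; punchInᵢ≢i; punchIn-punchOut; any?) renaming (_≟_ to _≟ᶠ_)
open import Data.Nat using (ℕ; zero; suc; _+_)
open import Data.Product using (∃; _×_; _,_; proj₁; proj₂)
open import Data.Vec using (lookup; zipWith)
open import Data.Vec.Properties using (lookup∘tabulate; lookup-zipWith)
open import Data.Vec.Functional using (removeAt; updateAt)
open import Data.Vec.Functional.Properties using (updateAt-updates; updateAt-minimal)
open import Data.Vec.Relation.Binary.Pointwise.Extensional using (ext; Pointwise-≡⇒≡)
open import Function using (_∘_; _⇔_; mk⇔)
open import Function.Construct.Composition using (_⇔-∘_)
open import Function.Construct.Symmetry using (⇔-sym)
open import Function.Definitions using (Injective)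
open import Relation.Nullary using (¬_; yes; no)
open import Relation.Binary.PropositionalEquality

Σ<-cong : ∀ k {f g : Fin k → ℕ} → (∀ a → f a ≡ g a) → Σ< k f ≡ Σ< k g
Σ<-cong zero    f≗g = refl
Σ<-cong (suc k) f≗g = cong₂ _+_ (f≗g zero) (Σ<-cong k (f≗g ∘ suc))

Σ<≡sum : ∀ k (f : Fin k → ℕ) → Σ< k f ≡ sum f
Σ<≡sum zero    f = refl
Σ<≡sum (suc k) f = cong (f zero +_) (Σ<≡sum k (f ∘ suc))

Σ<-removeAt : ∀ k (f : Fin (suc k) → ℕ) p → Σ< (suc k) f ≡ f p + Σ< k (removeAt f p)
Σ<-removeAt k f p = begin
  Σ< (suc k) f             ≡⟨ Σ<≡sum (suc k) f ⟩
  sum f                    ≡⟨ sum-remove f ⟩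
  f p + sum (removeAt f p) ≡⟨ cong (f p +_) (Σ<≡sum k (removeAt f p)) ⟨
  f p + Σ< k (removeAt f p) ∎
  where open ≡-Reasoning

Σ<-zeros : ∀ k {f : Fin k → ℕ} → (∀ a → f a ≡ 0) → Σ< k f ≡ 0
Σ<-zeros zero    f≗0 = refl
Σ<-zeros (suc k) f≗0 = cong₂ _+_ (f≗0 zero) (Σ<-zeros k (f≗0 ∘ suc))

Σ<-single : ∀ k {f : Fin k → ℕ} a → (∀ b → b ≢ a → f b ≡ 0) → Σ< k f ≡ f a
Σ<-single (suc k) {f} a others = begin
  Σ< (suc k) f              ≡⟨ Σ<-removeAt k f a ⟩
  f a + Σ< k (removeAt f a) ≡⟨ cong (f a +_) (Σ<-zeros k (λ c → others _ (punchInᵢ≢i a c))) ⟩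
  f a + 0                   ≡⟨ +-identityʳ (f a) ⟩
  f a                       ∎
  where open ≡-Reasoning

Σ<-increaseAt : ∀ k {f g : Fin k → ℕ} q d → g q ≡ f q + d → (∀ r → r ≢ q → g r ≡ f r) →
                Σ< k g ≡ Σ< k f + d
Σ<-increaseAt (suc k) {f} {g} q d gq others = begin
  Σ< (suc k) g                    ≡⟨ Σ<-removeAt k g q ⟩
  g q + Σ< k (removeAt g q)       ≡⟨ cong₂ _+_ gq (Σ<-cong k (λ c → others _ (punchInᵢ≢i q c))) ⟩
  f q + d + Σ< k (removeAt f q)   ≡⟨ xy∙z≈xz∙y (f q) d _ ⟩
  f q + Σ< k (removeAt f q) + d   ≡⟨ cong (_+ d) (Σ<-removeAt k f q) ⟨
  Σ< (suc k) f + d                ∎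
  where open ≡-Reasoning

val-injective : ∀ {a b} → val a ≡ val b → a ≡ b
val-injective {false} {false} _ = refl
val-injective {true}  {true}  _ = refl

contribution : Bool → Bool → ℕ
contribution s b = if s then val b else 0

contribution-false : ∀ s → contribution s false ≡ 0
contribution-false false = refl
contribution-false true  = refl

contribution-true : ∀ s → contribution s true ≡ val s
contribution-true false = refl
contribution-true true  = refl

contribution-∨ : ∀ s {a b} → ¬ (a ≡ true × b ≡ true) →
                 contribution s (a ∨ b) ≡ contribution s a + contribution s b
contribution-∨ false             _        = refl
contribution-∨ true {false}      _        = refl
contribution-∨ true {true} {false} _      = refl
contribution-∨ true {true} {true}  a∧b≢1 = ⊥-elim (a∧b≢1 (refl , refl))

combination : ∀ {n k} → (Fin k → BinVec n) → (Fin k → Bool) → Fin n → ℕ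
combination {k = k} e S i = Σ< k (λ a → contribution (S a) (lookup (e a) i))

removeAt-injective : ∀ {A : Set} {k} {e : Fin (suc k) → A} p →
                     Injective _≡_ _≡_ e → Injective _≡_ _≡_ (removeAt e p)
removeAt-injective p e-inj eq = punchIn-injective p _ _ (e-inj eq)

updateAt-injective : ∀ {A : Set} {k} {e : Fin k → A} {f : A → A} q → Injective _≡_ _≡_ e →
                     (∀ r → r ≢ q → f (e q) ≢ e r) → Injective _≡_ _≡_ (updateAt e q f)
updateAt-injective {e = e} {f} q e-inj fresh {r} {s} eq with r ≟ᶠ q | s ≟ᶠ q
... | yes refl | yes refl = refl
... | no r≢q   | no s≢q   =
  e-inj (trans (sym (updateAt-minimal r q e r≢q)) (trans eq (updateAt-minimal s q e s≢q)))
... | yes refl | no s≢q   = ⊥-elim (fresh s s≢q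
  (trans (sym (updateAt-updates q e)) (trans eq (updateAt-minimal s q e s≢q))))
... | no r≢q   | yes refl = ⊥-elim (fresh r r≢q
  (trans (sym (updateAt-updates q e)) (trans (sym eq) (updateAt-minimal r q e r≢q))))

combination-removeAt : ∀ {n k} (e : Fin (suc k) → BinVec n) S p i →
                       contribution (S p) (lookup (e p) i) ≡ 0 →
                       combination (removeAt e p) (removeAt S p) i ≡ combination e S i
combination-removeAt {k = k} e S p i p-silent =
  sym (trans (Σ<-removeAt k (λ a → contribution (S a) (lookup (e a) i)) p)
             (cong (_+ combination (removeAt e p) (removeAt S p) i) p-silent))

-- q absorbs p; removing p afterwards replaces the pair by its union.
merge : ∀ {n k} → (Fin k → BinVec n) → Fin k → Fin k → Fin k → BinVec n
merge e p q = updateAt e q (λ v → zipWith _∨_ v (e p))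

combination-merge : ∀ {n k} (e : Fin (suc k) → BinVec n) S {p q} → p ≢ q → S p ≡ S q → ∀ i →
                    ¬ (lookup (e q) i ≡ true × lookup (e p) i ≡ true) →
                    combination (removeAt (merge e p q) p) (removeAt S p) i ≡ combination e S i
combination-merge {k = k} e S {p} {q} p≢q Sp≡Sq i disjoint = begin
  Σ< k (removeAt (term (merge e p q)) p) ≡⟨ Σ<-increaseAt k q′ (term e p) merged-at-q untouched ⟩
  Σ< k (removeAt (term e) p) + term e p  ≡⟨ +-comm _ (term e p) ⟩
  term e p + Σ< k (removeAt (term e) p)  ≡⟨ Σ<-removeAt k (term e) p ⟨
  combination e S i                      ∎
  where
  open ≡-Reasoning
  term : (Fin (suc k) → BinVec _) → Fin (suc k) → ℕ
  term e′ a = contribution (S a) (lookup (e′ a) i)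
  q′ : Fin k
  q′ = punchOut p≢q
  merged-at-q : term (merge e p q) (punchIn p q′) ≡ term e (punchIn p q′) + term e p
  merged-at-q rewrite punchIn-punchOut p≢q = begin
    contribution (S q) (lookup (merge e p q q) i)
      ≡⟨ cong (λ v → contribution (S q) (lookup v i)) (updateAt-updates q e) ⟩
    contribution (S q) (lookup (zipWith _∨_ (e q) (e p)) i)
      ≡⟨ cong (contribution (S q)) (lookup-zipWith _∨_ i (e q) (e p)) ⟩
    contribution (S q) (lookup (e q) i ∨ lookup (e p) i)
      ≡⟨ contribution-∨ (S q) disjoint ⟩
    term e q + contribution (S q) (lookup (e p) i)
      ≡⟨ cong (λ s → term e q + contribution s (lookup (e p) i)) Sp≡Sq ⟨
    term e q + term e p
      ∎
  untouched : ∀ r → r ≢ q′ → term (merge e p q) (punchIn p r) ≡ term e (punchIn p r)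
  untouched r r≢q′ = cong (λ v → contribution (S (punchIn p r)) (lookup v i))
    (updateAt-minimal (punchIn p r) q e
      (λ eq → r≢q′ (punchIn-injective p r q′ (trans eq (sym (punchIn-punchOut p≢q))))))

base-vector-contributes : ∀ {n m} {A : BinMatrix n m} {X : VecSet n} (base : IsBase A X) p →
  ¬ (∀ j i → contribution (proj₁ (proj₁ base j) p) (lookup (elem X p) i) ≡ 0)
base-vector-contributes {X = record { size = zero }} _ ()
base-vector-contributes {A = A} {X = record { size = suc k ; elem = e ; distinct = e-inj }}
                        (spans , minimal) p silent = n≮n k (minimal smaller smaller-spans)
  where
  smaller : VecSet _
  smaller = record { size = k ; elem = removeAt e p ; distinct = removeAt-injective p e-inj }
  smaller-spans : SpansAllColumns A smaller
  smaller-spans j = removeAt (proj₁ (spans j)) p , λ i →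
    trans (combination-removeAt e (proj₁ (spans j)) p i (silent j i)) (proj₂ (spans j) i)

base-coefficients-distinct : ∀ {n m} {A : BinMatrix n m} {X : VecSet n} (base : IsBase A X) →
  DisjointInRows X → ∀ {p q i₀} → p ≢ q → lookup (elem X q) i₀ ≡ true →
  ¬ (∀ j → proj₁ (proj₁ base j) p ≡ proj₁ (proj₁ base j) q)
base-coefficients-distinct {X = record { size = zero }} _ _ {p = ()}
base-coefficients-distinct {A = A} {X = record { size = suc k ; elem = e ; distinct = e-inj }}
                           (spans , minimal) disjoint {p} {q} {i₀} p≢q q∋i₀ same =
  n≮n k (minimal smaller smaller-spans)
  where
  -- only e q has a 1 at row i₀, so e q ∨ e p is a new vector
  merged-fresh : ∀ r → r ≢ q → zipWith _∨_ (e q) (e p) ≢ e r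
  merged-fresh r r≢q eq = disjoint r q r≢q i₀
    (trans (cong (λ v → lookup v i₀) (sym eq))
           (trans (lookup-zipWith _∨_ i₀ (e q) (e p)) (cong (_∨ lookup (e p) i₀) q∋i₀)) , q∋i₀)
  smaller : VecSet _
  smaller = record
    { size = k
    ; elem = removeAt (merge e p q) p
    ; distinct = removeAt-injective p (updateAt-injective q e-inj merged-fresh)
    }
  smaller-spans : SpansAllColumns A smaller
  smaller-spans j = removeAt (proj₁ (spans j)) p , λ i →
    trans (combination-merge e (proj₁ (spans j)) p≢q (same j) i (disjoint q p (p≢q ∘ sym) i))
          (proj₂ (spans j) i)

module DisjointBase {n m} (A : BinMatrix n m) (X : VecSet n)
                    (base : IsBase A X) (disjoint : DisjointInRows X) where

  coefficient : Fin m → Fin (size X) → Bool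
  coefficient j = proj₁ (proj₁ base j)

  combination-coefficient : ∀ j i → combination (elem X) (coefficient j) i ≡ val (A i j)
  combination-coefficient j i =
    trans (proj₂ (proj₁ base j) i) (cong val (lookup∘tabulate (λ i → A i j) i))

  entry-covered : ∀ {a i} j → lookup (elem X a) i ≡ true → A i j ≡ coefficient j a
  entry-covered {a} {i} j a∋i = val-injective (begin
    val (A i j)                                          ≡⟨ combination-coefficient j i ⟨
    combination (elem X) (coefficient j) i               ≡⟨ Σ<-single (size X) a others-silent ⟩
    contribution (coefficient j a) (lookup (elem X a) i) ≡⟨ cong (contribution (coefficient j a)) a∋i ⟩
    contribution (coefficient j a) true                  ≡⟨ contribution-true (coefficient j a) ⟩
    val (coefficient j a)                                ∎)
    where
    open ≡-Reasoning
    others-silent : ∀ b → b ≢ a → contribution (coefficient j b) (lookup (elem X b) i) ≡ 0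
    others-silent b b≢a =
      trans (cong (contribution (coefficient j b)) (¬-not λ b∋i → disjoint b a b≢a i (b∋i , a∋i)))
            (contribution-false (coefficient j b))

  entry-uncovered : ∀ {i} j → (∀ a → lookup (elem X a) i ≡ false) → A i j ≡ false
  entry-uncovered {i} j uncovered = val-injective (trans (sym (combination-coefficient j i))
    (Σ<-zeros (size X) λ a → trans (cong (contribution (coefficient j a)) (uncovered a))
                                   (contribution-false (coefficient j a))))

  row-covered : ∀ {i j} → A i j ≡ true → ∃ λ a → lookup (elem X a) i ≡ true
  row-covered {i} {j} Aij≡1 with any? (λ a → lookup (elem X a) i ≟ᴮ true)
  ... | yes covered = covered
  ... | no ¬covered
    with trans (sym Aij≡1) (entry-uncovered j λ a → ¬-not λ a∋i → ¬covered (a , a∋i))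
  ...   | ()

  vector-nonzero : ∀ a → ∃ λ i → lookup (elem X a) i ≡ true
  vector-nonzero a with any? (λ i → lookup (elem X a) i ≟ᴮ true)
  ... | yes nonzero = nonzero
  ... | no ¬nonzero = ⊥-elim (base-vector-contributes {A = A} {X} base a λ j i →
    trans (cong (contribution (coefficient j a)) (¬-not (λ a∋i → ¬nonzero (i , a∋i))))
          (contribution-false (coefficient j a)))

  vector-used : ∀ a → ∃ λ j → coefficient j a ≡ true
  vector-used a with any? (λ j → coefficient j a ≟ᴮ true)
  ... | yes used = used
  ... | no ¬used = ⊥-elim (base-vector-contributes {A = A} {X} base a λ j i →
    cong (λ s → contribution s (lookup (elem X a) i)) (¬-not (λ used → ¬used (j , used))))

  coefficient-injective : ∀ {a b} → (∀ j → coefficient j a ≡ coefficient j b) → a ≡ b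
  coefficient-injective {a} {b} same with a ≟ᶠ b
  ... | yes a≡b = a≡b
  ... | no  a≢b = ⊥-elim
    (base-coefficients-distinct {A = A} {X} base disjoint a≢b (proj₂ (vector-nonzero b)) same)

  support-is-row-class : ∀ {a i₀} → lookup (elem X a) i₀ ≡ true →
                         ∀ i → lookup (elem X a) i ≡ true ⇔ (∀ j → A i j ≡ A i₀ j)
  support-is-row-class {a} {i₀} a∋i₀ i = mk⇔ same-row from-same-row
    where
    same-row : lookup (elem X a) i ≡ true → ∀ j → A i j ≡ A i₀ j
    same-row a∋i j = trans (entry-covered j a∋i) (sym (entry-covered j a∋i₀))
    from-same-row : (∀ j → A i j ≡ A i₀ j) → lookup (elem X a) i ≡ true
    from-same-row rows with vector-used a
    ... | j , used with row-covered (trans (rows j) (trans (entry-covered j a∋i₀) used))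
    ...   | b , b∋i = subst (λ c → lookup (elem X c) i ≡ true) b≡a b∋i
      where
      b≡a : b ≡ a
      b≡a = coefficient-injective λ j′ →
        trans (sym (entry-covered j′ b∋i)) (trans (rows j′) (entry-covered j′ a∋i₀))

module _ {n m} (A : BinMatrix n m) (X Y : VecSet n)
         (baseX : IsBase A X) (disjointX : DisjointInRows X)
         (baseY : IsBase A Y) (disjointY : DisjointInRows Y) where
  private
    module X = DisjointBase A X baseX disjointX
    module Y = DisjointBase A Y baseY disjointY

  disjoint-base-⊆ : ∀ a → ∃ λ b → elem Y b ≡ elem X a
  disjoint-base-⊆ a with X.vector-nonzero a | X.vector-used a
  ... | i₀ , a∋i₀ | j , used with Y.row-covered (trans (X.entry-covered j a∋i₀) used)
  ...   | b , b∋i₀ = b , Pointwise-≡⇒≡ (ext λ i →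
    ⇔→≡ (⇔-sym (X.support-is-row-class a∋i₀ i) ⇔-∘ Y.support-is-row-class b∋i₀ i))

mainTheorem15 : ∀ (n m : ℕ) (A : BinMatrix n m) (X Y : VecSet n) →
    IsBase A X → DisjointInRows X → IsBase A Y → DisjointInRows Y → SameSet X Y
mainTheorem15 n m A X Y baseX disjointX baseY disjointY =
  disjoint-base-⊆ A X Y baseX disjointX baseY disjointY ,
  disjoint-base-⊆ A Y X baseY disjointY baseX disjointX
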